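{- Let $r\geqslant 2$ and $1\leqslant s_1\leqslant\cdots\leqslant s_r$ be fixed integers, $F=K_{s_1,\ldots,s_r}$, $s=s_1+\cdots+s_r$. There is a constant $C$ depending only on $s_1,\ldots,s_r$ such that the following holds. Let $H$ be an $F$-saturated graph on $n$ vertices, let $A=\{x\in V(H)\mid \deg_H(x)\leqslant 2s-s_r-4\}$, and let $M\subseteq A$ be a set such that $|N_H(u,v)|\leqslant s-s_r-2$ for any two distinct vertices $u,v\in M$. Then $|M|\leqslant C$.
   Context: All graphs are finite, simple, undirected. $K_{s_1,\ldots,s_r}$ is the complete $r$-partite graph with parts of sizes $s_1,\ldots,s_r$. A graph $H$ is $F$-saturated if it contains no subgraph isomorphic to $F$ but adding any edge between two nonadjacent vertices creates a copy of $F$. $N_H(u,v)$ denotes the set of common neighbors of $u$ and $v$ in $H$. -}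

module Defs where

open import Data.Nat using (ℕ; zero; suc; _+_; _∸_; _≤_)
open import Data.Bool using (Bool; true; false; T)
open import Data.Fin using (Fin; toℕ)
open import Data.Fin.Properties using ()
open import Data.Vec using (Vec; lookup; []; _∷_)
open import Data.Vec.Functional as VF using ()
open import Data.List using (List; length; filter; allFin)
open import Data.Product using (Σ; _×_; _,_; proj₁; proj₂; ∃)
open import Relation.Binary.PropositionalEquality using (_≡_; refl; sym; trans; cong₂)
open import Data.Fin using (_≟_)
open import Relation.Nullary using (yes; no)
open import Data.Bool using (_∨_; _∧_)
open import Data.Bool.Properties using (∨-comm)
open import Data.Empty using (⊥-elim)
open import Relation.Nullary using (¬_)
open import Relation.Nullary.Decidable using (T?)
open import Data.Nat.ListAction using (sum)
open import Data.Vec using (toList)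

record Graph (n : ℕ) : Set where
  field
    adj   : Fin n → Fin n → Bool
    adj-sym : ∀ u v → adj u v ≡ adj v u
    adj-irrefl : ∀ v → adj v v ≡ false
open Graph public

Adj : ∀ {n} → Graph n → Fin n → Fin n → Set
Adj G u v = T (adj G u v)

deg : ∀ {n} → Graph n → Fin n → ℕ
deg {n} G x = length (filter (λ y → T? (adj G x y)) (allFin n))

codeg : ∀ {n} → Graph n → Fin n → Fin n → ℕ
codeg {n} G u v = length (filter (λ y → T? (adj G u y ∧ adj G v y)) (allFin n))

-- Vertices of K_{s_1,...,s_r}: pairs (part i, index within part i).
KVert : ∀ {r} → Vec ℕ r → Set
KVert {r} s = Σ (Fin r) (λ i → Fin (lookup s i))

KAdj : ∀ {r} (s : Vec ℕ r) → KVert s → KVert s → Set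
KAdj s a b = ¬ (proj₁ a ≡ proj₁ b)

ContainsK : ∀ {n r} → Vec ℕ r → Graph n → Set
ContainsK {n} s G =
  Σ (KVert s → Fin n) λ f →
    (∀ a b → f a ≡ f b → a ≡ b) ×
    (∀ a b → KAdj s a b → Adj G (f a) (f b))

isPair : ∀ {n} → Fin n → Fin n → Fin n → Fin n → Bool
isPair a b x y with x ≟ a | y ≟ b
... | yes _ | yes _ = true
... | _ | _ = false

isPair-diag : ∀ {n} (a b x : Fin n) → ¬ (a ≡ b) → isPair a b x x ≡ false
isPair-diag a b x a≢b with x ≟ a | x ≟ b
... | yes p | yes q = ⊥-elim (a≢b (trans (sym p) q))
... | yes _ | no _ = refl
... | no _ | _ = refl

addEdge : ∀ {n} → Graph n → (u v : Fin n) → ¬ (u ≡ v) → Graph n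
addEdge G u v u≢v = record
  { adj = λ x y → adj G x y ∨ (isPair u v x y ∨ isPair u v y x)
  ; adj-sym = λ x y → cong₂ _∨_ (adj-sym G x y) (∨-comm (isPair u v x y) (isPair u v y x))
  ; adj-irrefl = λ x → trans (cong₂ _∨_ (adj-irrefl G x)
                     (cong₂ _∨_ (isPair-diag u v x u≢v) (isPair-diag u v x u≢v))) refl }

Saturated : ∀ {n r} → Vec ℕ r → Graph n → Set
Saturated {n} s G =
  ¬ ContainsK s G ×
  (∀ u v (u≢v : ¬ (u ≡ v)) → ¬ Adj G u v → ContainsK s (addEdge G u v u≢v))

vsum : ∀ {r} → Vec ℕ r → ℕ
vsum s = sum (toList s)

SortedPos : ∀ {r} → Vec ℕ r → Set
SortedPos {r} s =
  (∀ i → 1 ≤ lookup s i) × (∀ (i j : Fin r) → toℕ i ≤ toℕ j → lookup s i ≤ lookup s j)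

-- last entry s_r of the vector (0 for the empty vector; only used with r ≥ 2)
lastPart : ∀ {r} → Vec ℕ r → ℕ
lastPart [] = 0
lastPart (x ∷ []) = x
lastPart (x ∷ y ∷ xs) = lastPart (y ∷ xs)

{-# OPTIONS --safe #-}
-- Colour each pair u, v of M (u before v) by how u and v see each other and the vertices of
-- the copy of K_s that saturation creates in H + uv: as itself, as a non-neighbour, or as the
-- α-th neighbour.  Degrees in M are bounded, so there are boundedly many colours, and Ramsey's
-- theorem turns a large M into a long monochromatic sequence z₀, z₁, ….  Homogeneity rules out
-- the edge z₀zₖ (z₁ and z₂ would be the same neighbour of z₀).  In the copy for z₀zₖ, with z₀
-- in part i and zₖ in part j, the bound on |N(z₀, zₖ)| forces a vertex of part i adjacent to zₖ
-- but not to z₀, and a vertex of part j adjacent to z₀ but not to zₖ.  Taking these vertices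
-- from the copies for the pairs (z₀, z_{k+t}) and (z_t, zₖ) respectively gives new parts i and
-- j, which homogeneity makes pairwise distinct and completely joined to each other and to the
-- remaining parts of the copy for z₀zₖ: a copy of K_s inside H.

module Submission where

open import Defs
open import Data.Nat using (ℕ; _+_; _*_; _≤_)
open import Data.Fin using (Fin)
open import Data.Vec using (Vec)
open import Data.List using (List; length)
open import Data.List.Relation.Unary.All using (All)
open import Data.List.Relation.Unary.Unique.Propositional using (Unique)
open import Data.Product using (Σ)
open import Relation.Binary.PropositionalEquality using (_≡_)
open import Relation.Nullary using (¬_)
open import Data.List.Membership.Propositional using (_∈_)

open import Data.Nat using (zero; suc; _<_; z≤n; s≤s; z<s; _<?_)
open import Data.Nat.Properties
open import Data.Fin as Fin using (toℕ) renaming (zero to fzero; suc to fsuc)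
open import Data.Fin.Properties using (toℕ-injective; toℕ<n)
open import Data.Vec using ([]; _∷_; lookup)
open import Data.List using ([]; _∷_; map; filter; _++_; allFin; upTo; cartesianProductWith)
import Data.List as List
open import Data.List.Properties using (length-map; length-++; length-tabulate; ∷-injective; filter-≐; filter-notAll)
open import Data.List.Relation.Unary.All using ([]; _∷_)
import Data.List.Relation.Unary.All as All
import Data.List.Relation.Unary.All.Properties as All
open import Data.List.Relation.Unary.Any using (here; there)
import Data.List.Relation.Unary.Any as Any
open import Data.List.Relation.Unary.Any.Properties using (lookup-index)
open import Data.List.Relation.Unary.AllPairs using (AllPairs; []; _∷_)
import Data.List.Relation.Unary.AllPairs.Properties as AllPairs
import Data.List.Relation.Unary.Unique.Propositional.Properties as Unique
open import Data.List.Membership.Propositional using (lose)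
open import Data.List.Membership.Propositional.Properties
  using (∈-filter⁺; ∈-filter⁻; ∈-map⁺; ∈-map⁻; ∈-++⁺ˡ; ∈-++⁺ʳ; ∈-allFin; ∈-upTo⁺; ∈-cartesianProductWith⁺)
import Data.List.Relation.Binary.Sublist.Propositional.Properties as Sublist
open import Data.Product using (_×_; _,_; proj₁; proj₂; ∃; ∃-syntax; Σ-syntax)
open import Data.Sum using (inj₁; inj₂)
open import Data.Empty using (⊥-elim)
open import Data.Bool using (T; _∧_)
open import Data.Bool.Properties using (T-∧; T-∨; ∧-comm)
open import Function using (_∘_)
open import Function.Bundles using (Equivalence)
open import Relation.Nullary using (Dec; yes; no; ¬?)
open import Relation.Nullary.Decidable using (map′; _×-dec_; T?)
open import Relation.Unary using (Decidable)
open import Relation.Binary.Definitions using (DecidableEquality; tri<; tri≈; tri>)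
open import Relation.Binary.PropositionalEquality using (_≢_; refl; sym; trans; cong; cong₂; subst; subst₂; module ≡-Reasoning)

private
  variable
    A C : Set
    n r : ℕ

Unique-⊆⇒length≤ : DecidableEquality A → {xs ys : List A} →
                   Unique xs → (∀ {x} → x ∈ xs → x ∈ ys) → length xs ≤ length ys
Unique-⊆⇒length≤ _≟_ {[]} _ _ = z≤n
Unique-⊆⇒length≤ _≟_ {x ∷ xs} {ys} (x∉xs ∷ xs!) xs⊆ys = begin-strict
  length xs                           ≤⟨ Unique-⊆⇒length≤ _≟_ xs! xs⊆ys-x ⟩
  length (filter (¬? ∘ (x ≟_)) ys)    <⟨ filter-notAll (¬? ∘ (x ≟_)) ys x-rejected ⟩
  length ys                           ∎
  where
    open ≤-Reasoning
    x-rejected = Any.map (λ x≡y x≢y → x≢y x≡y) (xs⊆ys (here refl))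
    xs⊆ys-x : ∀ {y} → y ∈ xs → y ∈ filter (¬? ∘ (x ≟_)) ys
    xs⊆ys-x y∈xs = ∈-filter⁺ (¬? ∘ (x ≟_)) (xs⊆ys (there y∈xs)) (All.lookup x∉xs y∈xs)

length-filter-split : {P : A → Set} (P? : Decidable P) (xs : List A) →
                      length (filter P? xs) + length (filter (¬? ∘ P?) xs) ≡ length xs
length-filter-split P? [] = refl
length-filter-split P? (x ∷ xs) with P? x
... | yes _ = cong suc (length-filter-split P? xs)
... | no _  = trans (+-suc _ _) (cong suc (length-filter-split P? xs))

map-pointwise : {f g : A → C} (xs : List A) → map f xs ≡ map g xs → ∀ {x} → x ∈ xs → f x ≡ g x
map-pointwise (y ∷ ys) eq (here refl) = proj₁ (∷-injective eq)
map-pointwise (y ∷ ys) eq (there x∈ys) = map-pointwise ys (proj₂ (∷-injective eq)) x∈ys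

words : List A → ℕ → List (List A)
words alphabet zero    = [] ∷ []
words alphabet (suc ℓ) = cartesianProductWith _∷_ alphabet (words alphabet ℓ)

∈-words : {alphabet xs : List A} → All (_∈ alphabet) xs → xs ∈ words alphabet (length xs)
∈-words []             = here refl
∈-words (x∈ ∷ xs∈) = ∈-cartesianProductWith⁺ _∷_ x∈ (∈-words xs∈)

lookupOr : A → List A → ℕ → A
lookupOr d []       _       = d
lookupOr d (x ∷ xs) zero    = x
lookupOr d (x ∷ xs) (suc a) = lookupOr d xs a

All-lookupOr : {P : A → Set} (d : A) {xs : List A} → All P xs → ∀ {a} → a < length xs → P (lookupOr d xs a)
All-lookupOr d (px ∷ pxs) {zero}  _         = px
All-lookupOr d (px ∷ pxs) {suc a} (s≤s a<n) = All-lookupOr d pxs a<n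

AllPairs-lookupOr : {R : A → A → Set} (d : A) {xs : List A} → AllPairs R xs →
                    ∀ {a b} → a < b → b < length xs → R (lookupOr d xs a) (lookupOr d xs b)
AllPairs-lookupOr d (rx ∷ rxs) {zero}  {suc b} _         (s≤s b<n) = All-lookupOr d rx b<n
AllPairs-lookupOr d (rx ∷ rxs) {suc a} {suc b} (s≤s a<b) (s≤s b<n) = AllPairs-lookupOr d rxs a<b b<n

-- Pigeonhole principle and Ramsey's theorem for ordered pairs

pigeonhole : (_≟_ : DecidableEquality C) (g : A → C) (palette : List C) (q : ℕ) (zs : List A) →
             (∀ {z} → z ∈ zs → g z ∈ palette) → length palette * q < length zs →
             ∃[ κ ] κ ∈ palette × q < length (filter (λ z → g z ≟ κ) zs)
pigeonhole _≟_ g [] q (z ∷ zs) coloured _ with () ← coloured (here refl)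
pigeonhole _≟_ g (κ ∷ palette) q zs coloured big with q <? length (filter (λ z → g z ≟ κ) zs)
... | yes q<class = κ , here refl , q<class
... | no  q≮class =
  let κ′ , κ′∈ , q<class′ = pigeonhole _≟_ g palette q rest rest-coloured rest-big
  in κ′ , there κ′∈ , <-≤-trans q<class′ (class-in-rest κ′)
  where
    rest = filter (λ z → ¬? (g z ≟ κ)) zs

    rest-coloured : ∀ {z} → z ∈ rest → g z ∈ palette
    rest-coloured z∈rest with ∈-filter⁻ (λ z → ¬? (g z ≟ κ)) {xs = zs} z∈rest
    ... | z∈zs , gz≢κ with coloured z∈zs
    ...   | here gz≡κ = ⊥-elim (gz≢κ gz≡κ)
    ...   | there gz∈ = gz∈

    rest-big : length palette * q < length rest
    rest-big = +-cancelˡ-< q _ _ (begin-strict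
      q + length palette * q                                   <⟨ big ⟩
      length zs                                                ≡⟨ length-filter-split (λ z → g z ≟ κ) zs ⟨
      length (filter (λ z → g z ≟ κ) zs) + length rest         ≤⟨ +-monoˡ-≤ (length rest) (≮⇒≥ q≮class) ⟩
      q + length rest                                          ∎)
      where open ≤-Reasoning

    class-in-rest : ∀ κ′ → length (filter (λ z → g z ≟ κ′) rest) ≤ length (filter (λ z → g z ≟ κ′) zs)
    class-in-rest κ′ = Sublist.length-mono-≤
      (Sublist.filter⁺ (λ z → g z ≟ κ′) (λ z → g z ≟ κ′) (λ { refl p → p })
                       (Sublist.filter-⊆ (λ z → ¬? (g z ≟ κ)) zs))

-- With T colours, a chain of length m can be extracted from any chainBound T m elements.
chainBound : ℕ → ℕ → ℕ
chainBound T zero    = 0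
chainBound T (suc m) = suc (suc (T * chainBound T m))

ramseyNumber : ℕ → ℕ → ℕ
ramseyNumber T t = chainBound T (suc (T * t))

module Ramsey (_≟_ : DecidableEquality C) (palette : List C) (c : A → A → C) where

  Coloured : List A → Set
  Coloured xs = ∀ {x y} → x ∈ xs → y ∈ xs → c x y ∈ palette

  Chain : List (A × C) → Set
  Chain = AllPairs (λ e e′ → proj₁ e ≢ proj₁ e′ × c (proj₁ e) (proj₁ e′) ≡ proj₂ e)

  chain : ∀ m xs → Unique xs → Coloured xs → chainBound (length palette) m ≤ length xs →
          Σ[ L ∈ List (A × C) ] Chain L × length L ≡ m × All (λ e → proj₁ e ∈ xs × proj₂ e ∈ palette) L
  chain zero    xs       _               _        _         = [] , [] , refl , []
  chain (suc m) (x ∷ ys) (x∉ys ∷ ys!) coloured (s≤s big) =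
    (x , κ) ∷ L , All.map head-step L⊆ ∷ L-chain , cong suc L-length ,
    (here refl , κ∈) ∷ All.map (λ (e∈ , κe∈) → there (class⊆ys e∈) , κe∈) L⊆
    where
      pigeon = pigeonhole _≟_ (c x) palette (chainBound (length palette) m) ys
                 (coloured (here refl) ∘ there) big
      κ = proj₁ pigeon
      κ∈ = proj₁ (proj₂ pigeon)
      class = filter (λ y → c x y ≟ κ) ys

      class⊆ys : ∀ {y} → y ∈ class → y ∈ ys
      class⊆ys y∈ = proj₁ (∈-filter⁻ (λ y → c x y ≟ κ) {xs = ys} y∈)

      rec = chain m class (Unique.filter⁺ (λ y → c x y ≟ κ) ys!)
                  (λ y∈ y′∈ → coloured (there (class⊆ys y∈)) (there (class⊆ys y′∈)))
                  (<⇒≤ (proj₂ (proj₂ pigeon)))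
      L = proj₁ rec
      L-chain = proj₁ (proj₂ rec)
      L-length = proj₁ (proj₂ (proj₂ rec))
      L⊆ = proj₂ (proj₂ (proj₂ rec))

      head-step : ∀ {e} → proj₁ e ∈ class × proj₂ e ∈ palette → x ≢ proj₁ e × c x (proj₁ e) ≡ κ
      head-step (e∈ , _) = All.lookup x∉ys (class⊆ys e∈) , proj₂ (∈-filter⁻ (λ y → c x y ≟ κ) {xs = ys} e∈)

  ramsey : ∀ t xs → Unique xs → Coloured xs → ramseyNumber (length palette) t ≤ length xs →
           Σ[ z ∈ (ℕ → A) ] Σ[ κ ∈ C ]
             (∀ {a} → a < t → z a ∈ xs) ×
             (∀ {a b} → a < b → b < t → z a ≢ z b × c (z a) (z b) ≡ κ)
  ramsey t (x ∷ xs) xs! coloured big =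
    z , κ , (λ a<t → proj₁ (All-lookupOr (x , κ) W⊆ (<-trans a<t t<W))) , z-homogeneous
    where
      built = chain (suc (length palette * t)) (x ∷ xs) xs! coloured big
      L = proj₁ built
      L-chain = proj₁ (proj₂ built)
      L-length = proj₁ (proj₂ (proj₂ built))
      L⊆ = proj₂ (proj₂ (proj₂ built))

      pigeon = pigeonhole _≟_ proj₂ palette t L (proj₂ ∘ All.lookup L⊆)
                 (subst (length palette * t <_) (sym L-length) ≤-refl)
      κ = proj₁ pigeon
      t<W = proj₂ (proj₂ pigeon)

      W = filter (λ e → proj₂ e ≟ κ) L

      W⊆ : All (λ e → proj₁ e ∈ x ∷ xs × proj₂ e ∈ palette) W
      W⊆ = All.filter⁺ (λ e → proj₂ e ≟ κ) L⊆

      W-chain : Chain W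
      W-chain = AllPairs.filter⁺ (λ e → proj₂ e ≟ κ) L-chain

      W-κ : All (λ e → proj₂ e ≡ κ) W
      W-κ = All.all-filter (λ e → proj₂ e ≟ κ) L

      z : ℕ → A
      z a = proj₁ (lookupOr (x , κ) W a)
      z-homogeneous : ∀ {a b} → a < b → b < t → z a ≢ z b × c (z a) (z b) ≡ κ
      z-homogeneous a<b b<t =
        let za≢zb , c≡κa = AllPairs-lookupOr (x , κ) W-chain a<b (<-trans b<t t<W)
        in za≢zb , trans c≡κa (All-lookupOr (x , κ) W-κ (<-trans (<-trans a<b b<t) t<W))

module _ {H : Graph n} where

  Adj-sym : ∀ {x y} → Adj H x y → Adj H y x
  Adj-sym {x} {y} = subst T (adj-sym H x y)

  Adj⇒≢ : ∀ {x y} → Adj H x y → x ≢ y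
  Adj⇒≢ {x} x~x refl = subst T (adj-irrefl H x) x~x

neighbours : Graph n → Fin n → List (Fin n)
neighbours {n} H u = filter (λ y → T? (adj H u y)) (allFin n)

common : Graph n → Fin n → Fin n → List (Fin n)
common {n} H u v = filter (λ y → T? (adj H u y ∧ adj H v y)) (allFin n)

module _ (H : Graph n) (u : Fin n) where

  ∈-neighbours⁺ : ∀ {x} → Adj H u x → x ∈ neighbours H u
  ∈-neighbours⁺ {x} = ∈-filter⁺ (λ y → T? (adj H u y)) (∈-allFin x)

  ∈-neighbours⁻ : ∀ {x} → x ∈ neighbours H u → Adj H u x
  ∈-neighbours⁻ x∈ = proj₂ (∈-filter⁻ (λ y → T? (adj H u y)) {xs = allFin _} x∈)

∈-common⁺ : ∀ {H : Graph n} {u v x} → Adj H u x → Adj H v x → x ∈ common H u v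
∈-common⁺ {H = H} {u} {v} {x} u~x v~x =
  ∈-filter⁺ (λ y → T? (adj H u y ∧ adj H v y)) (∈-allFin x) (Equivalence.from T-∧ (u~x , v~x))

codeg-sym : ∀ (H : Graph n) u v → codeg H u v ≡ codeg H v u
codeg-sym {n} H u v = cong length (filter-≐ _ _ (swap-∧ u v , swap-∧ v u) (allFin n))
  where
    swap-∧ : ∀ u v {y} → T (adj H u y ∧ adj H v y) → T (adj H v y ∧ adj H u y)
    swap-∧ u v {y} = subst T (∧-comm (adj H u y) (adj H v y))

data AdjPlus (H : Graph n) (u v x y : Fin n) : Set where
  old : Adj H x y → AdjPlus H u v x y
  uv  : x ≡ u → y ≡ v → AdjPlus H u v x y
  vu  : x ≡ v → y ≡ u → AdjPlus H u v x y

AdjPlus-swap : ∀ {H : Graph n} {u v x y} → AdjPlus H u v x y → AdjPlus H v u x y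
AdjPlus-swap (old x~y)       = old x~y
AdjPlus-swap (uv x≡u y≡v) = vu x≡u y≡v
AdjPlus-swap (vu x≡v y≡u) = uv x≡v y≡u

AdjPlus⇒Adj : ∀ {H : Graph n} {u v x y} → AdjPlus H u v x y → x ≢ u → x ≢ v → Adj H x y
AdjPlus⇒Adj (old x~y)   _   _   = x~y
AdjPlus⇒Adj (uv x≡u _) x≢u _   = ⊥-elim (x≢u x≡u)
AdjPlus⇒Adj (vu x≡v _) _   x≢v = ⊥-elim (x≢v x≡v)

isPair-true : ∀ (a b x y : Fin n) → T (isPair a b x y) → x ≡ a × y ≡ b
isPair-true a b x y _ with x Fin.≟ a | y Fin.≟ b
isPair-true a b x y _  | yes x≡a | yes y≡b = x≡a , y≡b
isPair-true a b x y () | yes _   | no _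
isPair-true a b x y () | no _    | _

addEdge-adj⁻ : ∀ {H : Graph n} {u v} (u≢v : u ≢ v) {x y} → Adj (addEdge H u v u≢v) x y → AdjPlus H u v x y
addEdge-adj⁻ {H = H} {u} {v} _ {x} {y} adjacent with Equivalence.to T-∨ adjacent
... | inj₁ x~y = old x~y
... | inj₂ new with Equivalence.to T-∨ new
...   | inj₁ xy = let x≡u , y≡v = isPair-true u v x y xy in uv x≡u y≡v
...   | inj₂ yx = let y≡u , x≡v = isPair-true u v y x yx in vu x≡v y≡u

-- How u sees x: as itself, as a non-neighbour, or as the α-th entry of neighbours H u
data Position : Set where
  self outside : Position
  neighbour    : ℕ → Position

neighbour-injective : ∀ {α β} → neighbour α ≡ neighbour β → α ≡ β
neighbour-injective refl = refl

_≟ₚ_ : DecidableEquality Position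
self        ≟ₚ self        = yes refl
outside     ≟ₚ outside     = yes refl
neighbour α ≟ₚ neighbour β = map′ (cong neighbour) neighbour-injective (α ≟ β)
self        ≟ₚ outside     = no λ ()
self        ≟ₚ neighbour _ = no λ ()
outside     ≟ₚ self        = no λ ()
outside     ≟ₚ neighbour _ = no λ ()
neighbour _ ≟ₚ self        = no λ ()
neighbour _ ≟ₚ outside     = no λ ()

position : Graph n → Fin n → Fin n → Position
position H u x with x Fin.≟ u | Any.any? (x Fin.≟_) (neighbours H u)
... | yes _ | _       = self
... | no _  | yes x∈ = neighbour (toℕ (Any.index x∈))
... | no _  | no _    = outside

positionsBelow : ℕ → List Position
positionsBelow D = self ∷ outside ∷ map neighbour (upTo D)

module _ {H : Graph n} {u : Fin n} where

  position-self : position H u u ≡ self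
  position-self with u Fin.≟ u
  ... | yes _   = refl
  ... | no u≢u = ⊥-elim (u≢u refl)

  position-self⁻ : ∀ {x} → position H u x ≡ self → x ≡ u
  position-self⁻ {x} eq with x Fin.≟ u | Any.any? (x Fin.≟_) (neighbours H u)
  position-self⁻ {x} eq  | yes x≡u | _     = x≡u
  position-self⁻ {x} () | no _    | yes _
  position-self⁻ {x} () | no _    | no _

  position-outside⁺ : ∀ {x} → x ≢ u → ¬ Adj H u x → position H u x ≡ outside
  position-outside⁺ {x} x≢u u≁x with x Fin.≟ u | Any.any? (x Fin.≟_) (neighbours H u)
  ... | yes x≡u | _      = ⊥-elim (x≢u x≡u)
  ... | no _    | yes x∈ = ⊥-elim (u≁x (∈-neighbours⁻ H u x∈))
  ... | no _    | no _   = refl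

  position-outside⁻ : ∀ {x} → position H u x ≡ outside → ¬ Adj H u x
  position-outside⁻ {x} eq u~x with x Fin.≟ u | Any.any? (x Fin.≟_) (neighbours H u)
  position-outside⁻ {x} () u~x | yes _ | _
  position-outside⁻ {x} () u~x | no _  | yes _
  position-outside⁻ {x} eq u~x | no _  | no x∉ = x∉ (∈-neighbours⁺ H u u~x)

  position-neighbour⁺ : ∀ {x} → Adj H u x → ∃[ α ] position H u x ≡ neighbour α
  position-neighbour⁺ {x} u~x with x Fin.≟ u | Any.any? (x Fin.≟_) (neighbours H u)
  ... | yes x≡u | _      = ⊥-elim (Adj⇒≢ {H = H} u~x (sym x≡u))
  ... | no _    | yes x∈ = _ , refl
  ... | no _    | no x∉  = ⊥-elim (x∉ (∈-neighbours⁺ H u u~x))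

  position-neighbour⁻ : ∀ {x α} → position H u x ≡ neighbour α →
                        Σ[ x∈ ∈ x ∈ neighbours H u ] toℕ (Any.index x∈) ≡ α
  position-neighbour⁻ {x} eq with x Fin.≟ u | Any.any? (x Fin.≟_) (neighbours H u)
  position-neighbour⁻ {x} () | yes _ | _
  position-neighbour⁻ {x} eq | no _  | yes x∈ = x∈ , neighbour-injective eq
  position-neighbour⁻ {x} () | no _  | no _

  position-neighbour-injective : ∀ {x y α} → position H u x ≡ neighbour α → position H u y ≡ neighbour α → x ≡ y
  position-neighbour-injective ux uy =
    let x∈ , x-index = position-neighbour⁻ ux
        y∈ , y-index = position-neighbour⁻ uy
        same-index = toℕ-injective (trans x-index (sym y-index))
    in begin
      _                                            ≡⟨ lookup-index x∈ ⟩
      List.lookup (neighbours H u) (Any.index x∈)  ≡⟨ cong (List.lookup (neighbours H u)) same-index ⟩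
      List.lookup (neighbours H u) (Any.index y∈)  ≡⟨ lookup-index y∈ ⟨
      _                                            ∎
    where open ≡-Reasoning

  position-∈-positionsBelow : ∀ {D x} → deg H u ≤ D → position H u x ∈ positionsBelow D
  position-∈-positionsBelow {D} {x} deg≤D with position H u x in eq
  ... | self        = here refl
  ... | outside     = there (here refl)
  ... | neighbour α =
    let x∈ , x-index = position-neighbour⁻ eq
    in there (there (∈-map⁺ neighbour (∈-upTo⁺ (subst (_< D) x-index (<-≤-trans (toℕ<n (Any.index x∈)) deg≤D)))))


position-self-transfer : ∀ {H : Graph n} {u x u′ x′} →
                         position H u x ≡ position H u′ x′ → x ≡ u → x′ ≡ u′
position-self-transfer {H = H} {u′ = u′} eq refl = position-self⁻ {H = H} {u = u′} (trans (sym eq) position-self)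

module _ {x : ℕ} {xs : Vec ℕ r} where

  inFirstPart : Fin x → KVert (x ∷ xs)
  inFirstPart t = fzero , t

  inLaterPart : KVert xs → KVert (x ∷ xs)
  inLaterPart (i , t) = fsuc i , t

  inLaterPart-injective : ∀ {p q} → inLaterPart p ≡ inLaterPart q → p ≡ q
  inLaterPart-injective {_ , _} {_ , _} refl = refl

allKVert : (s : Vec ℕ r) → List (KVert s)
allKVert []       = []
allKVert (x ∷ xs) = map inFirstPart (allFin x) ++ map inLaterPart (allKVert xs)

allKVert-unique : (s : Vec ℕ r) → Unique (allKVert s)
allKVert-unique []       = []
allKVert-unique (x ∷ xs) = Unique.++⁺ (Unique.map⁺ (λ { refl → refl }) (Unique.allFin⁺ x))
                                       (Unique.map⁺ inLaterPart-injective (allKVert-unique xs)) disjoint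
  where
    disjoint : ∀ {p} → ¬ (p ∈ map inFirstPart (allFin x) × p ∈ map inLaterPart (allKVert xs))
    disjoint (p∈₁ , p∈₂) with ∈-map⁻ inFirstPart p∈₁ | ∈-map⁻ inLaterPart p∈₂
    ... | _ , _ , refl | _ , _ , ()

allKVert-complete : (s : Vec ℕ r) (p : KVert s) → p ∈ allKVert s
allKVert-complete (x ∷ xs) (fzero , t)  = ∈-++⁺ˡ (∈-map⁺ inFirstPart (∈-allFin t))
allKVert-complete (x ∷ xs) (fsuc i , t) =
  ∈-++⁺ʳ (map inFirstPart (allFin x)) (∈-map⁺ inLaterPart (allKVert-complete xs (i , t)))

length-allKVert : (s : Vec ℕ r) → length (allKVert s) ≡ vsum s
length-allKVert []       = refl
length-allKVert (x ∷ xs) = begin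
  length (map first (allFin x) ++ map later (allKVert xs))            ≡⟨ length-++ (map first (allFin x)) ⟩
  length (map first (allFin x)) + length (map later (allKVert xs))    ≡⟨ cong₂ _+_ firsts laters ⟩
  x + vsum xs                                                         ∎
  where
    open ≡-Reasoning
    first = inFirstPart {x = x} {xs = xs}
    later = inLaterPart {x = x} {xs = xs}
    firsts = trans (length-map first (allFin x)) (length-tabulate _)
    laters = trans (length-map later (allKVert xs)) (length-allKVert xs)

partKVert : (s : Vec ℕ r) (j : Fin r) → List (KVert s)
partKVert s j = map (j ,_) (allFin (lookup s j))

∈-partKVert : (s : Vec ℕ r) {p : KVert s} → p ∈ partKVert s (proj₁ p)
∈-partKVert s {j , t} = ∈-map⁺ (j ,_) (∈-allFin t)

length-partKVert : (s : Vec ℕ r) (j : Fin r) → length (partKVert s j) ≡ lookup s j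
length-partKVert s j = trans (length-map _ (allFin (lookup s j))) (length-tabulate _)

lookup≤vsum : (s : Vec ℕ r) (i : Fin r) → lookup s i ≤ vsum s
lookup≤vsum (x ∷ xs) fzero    = m≤m+n x (vsum xs)
lookup≤vsum (x ∷ xs) (fsuc i) = ≤-trans (lookup≤vsum xs i) (m≤n+m (vsum xs) x)

lookup≤lastPart : (s : Vec ℕ r) → (∀ (i j : Fin r) → toℕ i ≤ toℕ j → lookup s i ≤ lookup s j) →
                  ∀ i → lookup s i ≤ lastPart s
lookup≤lastPart (x ∷ [])     sorted fzero    = ≤-refl
lookup≤lastPart (x ∷ y ∷ xs) sorted fzero    =
  ≤-trans (sorted fzero (fsuc fzero) z≤n) (lookup≤lastPart (y ∷ xs) (λ i j → sorted (fsuc i) (fsuc j) ∘ s≤s) fzero)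
lookup≤lastPart (x ∷ y ∷ xs) sorted (fsuc i) =
  lookup≤lastPart (y ∷ xs) (λ i j → sorted (fsuc i) (fsuc j) ∘ s≤s) i

KVert-≡ : {s : Vec ℕ r} {p q : KVert s} → proj₁ p ≡ proj₁ q → toℕ (proj₂ p) ≡ toℕ (proj₂ q) → p ≡ q
KVert-≡ {p = i , _} refl eq = cong (i ,_) (toℕ-injective eq)

KVert-any? : (s : Vec ℕ r) {P : KVert s → Set} → Decidable P → Dec (∃ P)
KVert-any? s P? = map′ Any.satisfied (λ (p , Pp) → lose (allKVert-complete s p) Pp) (Any.any? P? (allKVert s))

KAdj? : (s : Vec ℕ r) (p q : KVert s) → Dec (KAdj s p q)
KAdj? s p q = ¬? (proj₁ p Fin.≟ proj₁ q)

-- Copies of K_s through a new edge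

module CopyThroughNewEdge {H : Graph n} {s : Vec ℕ r} (K-free : ¬ ContainsK s H) {u v : Fin n}
  {f : KVert s → Fin n} (f-injective : ∀ p q → f p ≡ f q → p ≡ q)
  (f-adj : ∀ p q → KAdj s p q → AdjPlus H u v (f p) (f q)) where

  new-edge-used : ∃[ p ] ∃[ q ] KAdj s p q × f p ≡ u × f q ≡ v
  new-edge-used with KVert-any? s (λ p → KVert-any? s (λ q → KAdj? s p q ×-dec f p Fin.≟ u ×-dec f q Fin.≟ v))
  ... | yes used = used
  ... | no unused = ⊥-elim (K-free (f , f-injective , adj-in-H))
    where
      adj-in-H : ∀ p q → KAdj s p q → Adj H (f p) (f q)
      adj-in-H p q pq with f-adj p q pq
      ... | old fp~fq      = fp~fq
      ... | uv fp≡u fq≡v = ⊥-elim (unused (p , q , pq , fp≡u , fq≡v))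
      ... | vu fp≡v fq≡u = ⊥-elim (unused (q , p , pq ∘ sym , fq≡u , fp≡v))

  ũ ṽ : KVert s
  ũ = proj₁ new-edge-used
  ṽ = proj₁ (proj₂ new-edge-used)

  i j : Fin r
  i = proj₁ ũ
  j = proj₁ ṽ

  i≢j : i ≢ j
  i≢j = proj₁ (proj₂ (proj₂ new-edge-used))

  f-ũ : f ũ ≡ u
  f-ũ = proj₁ (proj₂ (proj₂ (proj₂ new-edge-used)))

  f-ṽ : f ṽ ≡ v
  f-ṽ = proj₂ (proj₂ (proj₂ (proj₂ new-edge-used)))

  ≢u-off-i : ∀ {p} → proj₁ p ≢ i → f p ≢ u
  ≢u-off-i {p} p∉i fp≡u = p∉i (cong proj₁ (f-injective p ũ (trans fp≡u (sym f-ũ))))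

  ≢v-off-j : ∀ {p} → proj₁ p ≢ j → f p ≢ v
  ≢v-off-j {p} p∉j fp≡v = p∉j (cong proj₁ (f-injective p ṽ (trans fp≡v (sym f-ṽ))))

  adj-in-H : ∀ {p q} → KAdj s p q → f p ≢ u → f p ≢ v → Adj H (f p) (f q)
  adj-in-H {p} {q} pq = AdjPlus⇒Adj (f-adj p q pq)

  adj-u : ∀ {p} → proj₁ p ≢ i → f p ≢ v → Adj H u (f p)
  adj-u p∉i fp≢v = Adj-sym {H = H} (subst (Adj H _) f-ũ (adj-in-H p∉i (≢u-off-i p∉i) fp≢v))

  adj-v : ∀ {p} → proj₁ p ≢ j → f p ≢ u → Adj H v (f p)
  adj-v p∉j fp≢u = Adj-sym {H = H} (subst (Adj H _) f-ṽ (adj-in-H p∉j fp≢u (≢v-off-j p∉j)))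

  Escape : KVert s → Set
  Escape p = proj₁ p ≡ i × f p ≢ u × ¬ Adj H u (f p)

  -- all vertices outside part j except ũ would then lie in N(u, v)
  vsum≤-without-escape : ¬ ∃ Escape → vsum s ≤ suc (lookup s j + codeg H u v)
  vsum≤-without-escape none = begin
    vsum s                                               ≡⟨ length-allKVert s ⟨
    length (allKVert s)                                  ≡⟨ length-map f (allKVert s) ⟨
    length (map f (allKVert s))                          ≤⟨ Unique-⊆⇒length≤ Fin._≟_ images-unique covered ⟩
    length (u ∷ map f (partKVert s j) ++ common H u v)   ≡⟨ cong suc (length-++ (map f (partKVert s j))) ⟩
    suc (length (map f (partKVert s j)) + codeg H u v)   ≡⟨ cong (λ m → suc (m + codeg H u v)) part-length ⟩
    suc (lookup s j + codeg H u v)                       ∎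
    where
      open ≤-Reasoning
      images-unique = Unique.map⁺ (f-injective _ _) (allKVert-unique s)
      part-length = trans (length-map f (partKVert s j)) (length-partKVert s j)

      adj-u-in-i : ∀ {p} → proj₁ p ≡ i → f p ≢ u → Adj H u (f p)
      adj-u-in-i {p} p∈i fp≢u with T? (adj H u (f p))
      ... | yes u~fp = u~fp
      ... | no u≁fp  = ⊥-elim (none (p , p∈i , fp≢u , u≁fp))

      covered : ∀ {x} → x ∈ map f (allKVert s) → x ∈ u ∷ map f (partKVert s j) ++ common H u v
      covered x∈ with ∈-map⁻ f x∈
      ... | p , _ , refl with proj₁ p Fin.≟ j | f p Fin.≟ u
      ...   | yes refl | _        = there (∈-++⁺ˡ (∈-map⁺ f (∈-partKVert s)))
      ...   | no _     | yes fp≡u = here fp≡u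
      ...   | no p∉j   | no fp≢u  with proj₁ p Fin.≟ i
      ...     | yes p∈i = there (∈-++⁺ʳ _ (∈-common⁺ {H = H} (adj-u-in-i p∈i fp≢u) (adj-v p∉j fp≢u)))
      ...     | no p∉i  = there (∈-++⁺ʳ _ (∈-common⁺ {H = H} (adj-u p∉i (≢v-off-j p∉j)) (adj-v p∉j fp≢u)))

  escape-from-u : codeg H u v + lookup s j + 2 ≤ vsum s → ∃ Escape
  escape-from-u sparse
    with KVert-any? s (λ p → proj₁ p Fin.≟ i ×-dec ¬? (f p Fin.≟ u) ×-dec ¬? (T? (adj H u (f p))))
  ... | yes escaping = escaping
  ... | no none = ⊥-elim (<-irrefl refl (begin-strict
    vsum s                           ≤⟨ vsum≤-without-escape none ⟩
    suc (lookup s j + codeg H u v)   <⟨ ≤-reflexive (trans (cong (2 +_) (+-comm (lookup s j) _)) (+-comm 2 _)) ⟩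
    codeg H u v + lookup s j + 2     ≤⟨ sparse ⟩
    vsum s                           ∎))
    where open ≤-Reasoning

-- Colouring pairs by how they see each other and their completions

data Observation (s : Vec ℕ r) : Set where
  pair                 : Observation s
  fromFirst fromSecond : KVert s → Observation s

observations : (s : Vec ℕ r) → List (Observation s)
observations s = pair ∷ map fromFirst (allKVert s) ++ map fromSecond (allKVert s)

∈-observations : (s : Vec ℕ r) (o : Observation s) → o ∈ observations s
∈-observations s pair           = here refl
∈-observations s (fromFirst p)  = there (∈-++⁺ˡ (∈-map⁺ fromFirst (allKVert-complete s p)))
∈-observations s (fromSecond p) = there (∈-++⁺ʳ _ (∈-map⁺ fromSecond (allKVert-complete s p)))

palette : Vec ℕ r → ℕ → List (List Position)
palette s D = words (positionsBelow D) (length (observations s))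

module Colouring {H : Graph n} {s : Vec ℕ r} (sat : Saturated s H) where

  -- the copy of K_s in H + uv given by saturation (junk unless u ≢ v and ¬ Adj H u v)
  completion : Fin n → Fin n → KVert s → Fin n
  completion u v with u Fin.≟ v | T? (adj H u v)
  ... | no u≢v | no u≁v = proj₁ (proj₂ sat u v u≢v u≁v)
  ... | _      | _      = λ _ → u

  completion-copy : ∀ {u v} → u ≢ v → ¬ Adj H u v →
    (∀ p q → completion u v p ≡ completion u v q → p ≡ q) ×
    (∀ p q → KAdj s p q → AdjPlus H u v (completion u v p) (completion u v q))
  completion-copy {u} {v} u≢v u≁v with u Fin.≟ v | T? (adj H u v)
  ... | yes u≡v | _       = ⊥-elim (u≢v u≡v)
  ... | no _    | yes u~v = ⊥-elim (u≁v u~v)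
  ... | no u≢v′ | no u≁v′ =
    let f-injective , f-adj = proj₂ (proj₂ sat u v u≢v′ u≁v′)
    in f-injective , λ p q pq → addEdge-adj⁻ {H = H} u≢v′ (f-adj p q pq)

  observe : Fin n → Fin n → Observation s → Position
  observe u v pair           = position H u v
  observe u v (fromFirst p)  = position H u (completion u v p)
  observe u v (fromSecond p) = position H v (completion u v p)

  colour : Fin n → Fin n → List Position
  colour u v = map (observe u v) (observations s)

  colour-≡ : ∀ {u v u′ v′} → colour u v ≡ colour u′ v′ → ∀ o → observe u v o ≡ observe u′ v′ o
  colour-≡ eq o = map-pointwise (observations s) eq (∈-observations s o)

  colour-∈-palette : ∀ {D u v} → deg H u ≤ D → deg H v ≤ D → colour u v ∈ palette s D
  colour-∈-palette {D} {u} {v} u≤D v≤D =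
    subst (λ ℓ → colour u v ∈ words (positionsBelow D) ℓ) (length-map (observe u v) (observations s))
          (∈-words (All.map⁺ (All.tabulate {xs = observations s} λ {o} _ → observed o)))
    where
      observed : ∀ o → observe u v o ∈ positionsBelow D
      observed pair           = position-∈-positionsBelow u≤D
      observed (fromFirst p)  = position-∈-positionsBelow u≤D
      observed (fromSecond p) = position-∈-positionsBelow v≤D

-- Homogeneous sequences

outside≢neighbour : ∀ {α} → outside ≢ neighbour α
outside≢neighbour ()

module FromHomogeneousSequence {H : Graph n} {s : Vec ℕ r} (sat : Saturated s H)
  (k : ℕ) (1<k : 1 < k) (vsum<k : vsum s < k) (z : ℕ → Fin n)
  (z-distinct : ∀ {a b} → a < b → b < k + k → z a ≢ z b)
  (z-homogeneous : ∀ {a b} → a < b → b < k + k →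
                   Colouring.colour {H = H} {s = s} sat (z a) (z b) ≡ Colouring.colour {H = H} {s = s} sat (z 0) (z k))
  (z-sparse : ∀ j → codeg H (z 0) (z k) + lookup s j + 2 ≤ vsum s) where

  open Colouring {H = H} {s = s} sat

  0<k : 0 < k
  0<k = <-trans z<s 1<k

  k<k+k : k < k + k
  k<k+k = m<m+n k 0<k

  k+t<k+k : ∀ {t} → t < k → k + t < k + k
  k+t<k+k = +-monoʳ-< k

  0<k+t : ∀ {t} → 0 < k + t
  0<k+t {t} = <-≤-trans 0<k (m≤m+n k t)

  t<k+t′ : ∀ {t t′} → t < k → t < k + t′
  t<k+t′ {t′ = t′} t<k = <-≤-trans t<k (m≤m+n k t′)

  F : ℕ → ℕ → KVert s → Fin n
  F a b = completion (z a) (z b)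

  pair-position : ∀ {a b} → a < b → b < k + k → position H (z a) (z b) ≡ position H (z 0) (z k)
  pair-position a<b b<2k = colour-≡ (z-homogeneous a<b b<2k) pair

  first-position : ∀ {a b} → a < b → b < k + k → ∀ p → position H (z a) (F a b p) ≡ position H (z 0) (F 0 k p)
  first-position a<b b<2k p = colour-≡ (z-homogeneous a<b b<2k) (fromFirst p)

  second-position : ∀ {a b} → a < b → b < k + k → ∀ p → position H (z b) (F a b p) ≡ position H (z k) (F 0 k p)
  second-position a<b b<2k p = colour-≡ (z-homogeneous a<b b<2k) (fromSecond p)

  z0≢zk : z 0 ≢ z k
  z0≢zk = z-distinct 0<k k<k+k

  -- otherwise z 1 and z 2 would both be the same neighbour of z 0
  z0≁zk : ¬ Adj H (z 0) (z k)
  z0≁zk z0~zk = z-distinct 1<2 2<k+k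
    (position-neighbour-injective (trans (pair-position 0<1 1<k+k) (proj₂ α)) (trans (pair-position 0<2 2<k+k) (proj₂ α)))
    where
      α = position-neighbour⁺ z0~zk
      0<1 = s≤s z≤n
      0<2 = s≤s z≤n
      1<2 = s≤s (s≤s z≤n)
      1<k+k = <-≤-trans 1<k (m≤m+n k k)
      2<k+k = +-mono-< 1<k 1<k

  z-nonadjacent : ∀ {a b} → a < b → b < k + k → ¬ Adj H (z a) (z b)
  z-nonadjacent a<b b<2k =
    position-outside⁻ (trans (pair-position a<b b<2k) (position-outside⁺ (z0≢zk ∘ sym) z0≁zk))

  F-copy : ∀ {a b} → a < b → b < k + k →
    (∀ p q → F a b p ≡ F a b q → p ≡ q) × (∀ p q → KAdj s p q → AdjPlus H (z a) (z b) (F a b p) (F a b q))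
  F-copy a<b b<2k = completion-copy (z-distinct a<b b<2k) (z-nonadjacent a<b b<2k)

  F-injective : ∀ {a b} → a < b → b < k + k → ∀ p q → F a b p ≡ F a b q → p ≡ q
  F-injective a<b b<2k = proj₁ (F-copy a<b b<2k)

  F-avoiding : ∀ {p a b} → F 0 k p ≢ z 0 → F 0 k p ≢ z k → a < b → b < k + k → F a b p ≢ z a × F a b p ≢ z b
  F-avoiding {p} ≢z0 ≢zk a<b b<2k =
    ≢z0 ∘ position-self-transfer (first-position a<b b<2k p) , ≢zk ∘ position-self-transfer (second-position a<b b<2k p)

  F-adj : ∀ {p q a b} → F 0 k p ≢ z 0 → F 0 k p ≢ z k → KAdj s p q → a < b → b < k + k →
          Adj H (F a b p) (F a b q)
  F-adj {p} {q} ≢z0 ≢zk pq a<b b<2k =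
    let ≢za , ≢zb = F-avoiding ≢z0 ≢zk a<b b<2k in AdjPlus⇒Adj (proj₂ (F-copy a<b b<2k) p q pq) ≢za ≢zb

  same-first : ∀ {p a b b′ α} → a < b → b < k + k → a < b′ → b′ < k + k →
               position H (z 0) (F 0 k p) ≡ neighbour α → F a b p ≡ F a b′ p
  same-first {p} a<b b<2k a<b′ b′<2k eq =
    position-neighbour-injective (trans (first-position a<b b<2k p) eq) (trans (first-position a<b′ b′<2k p) eq)

  same-second : ∀ {p a a′ b β} → a < b → a′ < b → b < k + k →
                position H (z k) (F 0 k p) ≡ neighbour β → F a b p ≡ F a′ b p
  same-second {p} a<b a′<b b<2k eq =
    position-neighbour-injective (trans (second-position a<b b<2k p) eq) (trans (second-position a′<b b<2k p) eq)

  open CopyThroughNewEdge {H = H} {s = s} (proj₁ sat) (F-injective 0<k k<k+k) (proj₂ (F-copy 0<k k<k+k))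
  -- the same copy, with the roles of z 0 and z k exchanged
  module Mirror = CopyThroughNewEdge {H = H} {s = s} (proj₁ sat) (F-injective 0<k k<k+k)
                    (λ p q pq → AdjPlus-swap (proj₂ (F-copy 0<k k<k+k) p q pq))

  Mirror-i≡j : Mirror.i ≡ j
  Mirror-i≡j = cong proj₁ (F-injective 0<k k<k+k _ _ (trans Mirror.f-ũ (sym f-ṽ)))

  pᵢ-escape : ∃ Escape
  pᵢ-escape = escape-from-u (z-sparse j)
  pⱼ-escape : ∃ Mirror.Escape
  pⱼ-escape = Mirror.escape-from-u
    (subst (λ m → m + lookup s Mirror.j + 2 ≤ vsum s) (codeg-sym H (z 0) (z k)) (z-sparse Mirror.j))

  pᵢ pⱼ : KVert s
  pᵢ = proj₁ pᵢ-escape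
  pⱼ = proj₁ pⱼ-escape

  pᵢ∈i : proj₁ pᵢ ≡ i
  pᵢ∈i = proj₁ (proj₂ pᵢ-escape)

  pⱼ∈j : proj₁ pⱼ ≡ j
  pⱼ∈j = trans (proj₁ (proj₂ pⱼ-escape)) Mirror-i≡j

  pᵢ∉j : proj₁ pᵢ ≢ j
  pᵢ∉j e = i≢j (trans (sym pᵢ∈i) e)

  pⱼ∉i : proj₁ pⱼ ≢ i
  pⱼ∉i e = i≢j (trans (sym e) pⱼ∈j)

  pᵢ-first : position H (z 0) (F 0 k pᵢ) ≡ outside
  pᵢ-first = position-outside⁺ (proj₁ (proj₂ (proj₂ pᵢ-escape))) (proj₂ (proj₂ (proj₂ pᵢ-escape)))

  pⱼ-second : position H (z k) (F 0 k pⱼ) ≡ outside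
  pⱼ-second = position-outside⁺ (proj₁ (proj₂ (proj₂ pⱼ-escape))) (proj₂ (proj₂ (proj₂ pⱼ-escape)))

  β-pᵢ : ∃[ β ] position H (z k) (F 0 k pᵢ) ≡ neighbour β
  β-pᵢ = position-neighbour⁺ (adj-v pᵢ∉j (proj₁ (proj₂ (proj₂ pᵢ-escape))))
  α-pⱼ : ∃[ α ] position H (z 0) (F 0 k pⱼ) ≡ neighbour α
  α-pⱼ = position-neighbour⁺ (adj-u pⱼ∉i (proj₁ (proj₂ (proj₂ pⱼ-escape))))

  pᵢ-second : position H (z k) (F 0 k pᵢ) ≡ neighbour (proj₁ β-pᵢ)
  pᵢ-second = proj₂ β-pᵢ

  pⱼ-first : position H (z 0) (F 0 k pⱼ) ≡ neighbour (proj₁ α-pⱼ)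
  pⱼ-first = proj₂ α-pⱼ

  Elsewhere : KVert s → Set
  Elsewhere q = proj₁ q ≢ i × proj₁ q ≢ j

  elsewhere-first : ∀ {q} → Elsewhere q → ∃[ α ] position H (z 0) (F 0 k q) ≡ neighbour α
  elsewhere-first (q∉i , q∉j) = position-neighbour⁺ (adj-u q∉i (≢v-off-j q∉j))

  elsewhere-second : ∀ {q} → Elsewhere q → ∃[ β ] position H (z k) (F 0 k q) ≡ neighbour β
  elsewhere-second (q∉i , q∉j) = position-neighbour⁺ (adj-v q∉j (≢u-off-i q∉i))

  -- the replacements for the t-th vertices of parts i and j
  wᵢ wⱼ : ℕ → Fin n
  wᵢ t = F 0 (k + t) pᵢ
  wⱼ t = F t k pⱼ

  wᵢ-anchor : ∀ {a t} → a < k + t → t < k → F a (k + t) pᵢ ≡ wᵢ t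
  wᵢ-anchor a<k+t t<k = same-second a<k+t 0<k+t (k+t<k+k t<k) pᵢ-second

  wⱼ-anchor : ∀ {t b} → t < b → b < k + k → t < k → F t b pⱼ ≡ wⱼ t
  wⱼ-anchor t<b b<2k t<k = same-first t<b b<2k t<k k<k+k pⱼ-first

  elsewhere-anchor-first : ∀ {q b} → Elsewhere q → 0 < b → b < k + k → F 0 b q ≡ F 0 k q
  elsewhere-anchor-first q-else 0<b b<2k = same-first 0<b b<2k 0<k k<k+k (proj₂ (elsewhere-first q-else))

  elsewhere-anchor-second : ∀ {q a} → Elsewhere q → a < k → F a k q ≡ F 0 k q
  elsewhere-anchor-second q-else a<k = same-second a<k 0<k k<k+k (proj₂ (elsewhere-second q-else))

  pᵢ-avoiding : F 0 k pᵢ ≢ z 0 × F 0 k pᵢ ≢ z k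
  pᵢ-avoiding = proj₁ (proj₂ (proj₂ pᵢ-escape)) , ≢v-off-j pᵢ∉j

  pⱼ-avoiding : F 0 k pⱼ ≢ z 0 × F 0 k pⱼ ≢ z k
  pⱼ-avoiding = ≢u-off-i pⱼ∉i , proj₁ (proj₂ (proj₂ pⱼ-escape))

  elsewhere-avoiding : ∀ {q} → Elsewhere q → F 0 k q ≢ z 0 × F 0 k q ≢ z k
  elsewhere-avoiding (q∉i , q∉j) = ≢u-off-i q∉i , ≢v-off-j q∉j

  pᵢ~pⱼ : KAdj s pᵢ pⱼ
  pᵢ~pⱼ e = i≢j (trans (sym pᵢ∈i) (trans e pⱼ∈j))

  wᵢ~wⱼ : ∀ {t t′} → t < k → t′ < k → Adj H (wᵢ t) (wⱼ t′)
  wᵢ~wⱼ t<k t′<k =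
    subst₂ (Adj H) (wᵢ-anchor (t<k+t′ t′<k) t<k) (wⱼ-anchor (t<k+t′ t′<k) (k+t<k+k t<k) t′<k)
      (F-adj (proj₁ pᵢ-avoiding) (proj₂ pᵢ-avoiding) pᵢ~pⱼ (t<k+t′ t′<k) (k+t<k+k t<k))

  wᵢ~elsewhere : ∀ {t q} → t < k → Elsewhere q → Adj H (wᵢ t) (F 0 k q)
  wᵢ~elsewhere t<k q-else@(q∉i , _) =
    subst (Adj H _) (elsewhere-anchor-first q-else 0<k+t (k+t<k+k t<k))
      (F-adj (proj₁ pᵢ-avoiding) (proj₂ pᵢ-avoiding) (λ e → q∉i (trans (sym e) pᵢ∈i)) 0<k+t (k+t<k+k t<k))

  wⱼ~elsewhere : ∀ {t q} → t < k → Elsewhere q → Adj H (wⱼ t) (F 0 k q)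
  wⱼ~elsewhere t<k q-else@(_ , q∉j) =
    subst (Adj H _) (elsewhere-anchor-second q-else t<k)
      (F-adj (proj₁ pⱼ-avoiding) (proj₂ pⱼ-avoiding) (λ e → q∉j (trans (sym e) pⱼ∈j)) t<k k<k+k)

  elsewhere~ : ∀ {p q} → Elsewhere p → KAdj s p q → Adj H (F 0 k p) (F 0 k q)
  elsewhere~ p-else pq =
    F-adj (proj₁ (elsewhere-avoiding p-else)) (proj₂ (elsewhere-avoiding p-else)) pq 0<k k<k+k

  -- F (k + t) (k + t′) pᵢ is wᵢ t′ but lies outside N(z (k + t)), while wᵢ t does not
  wᵢ-injective-< : ∀ {t t′} → t < t′ → t′ < k → wᵢ t ≢ wᵢ t′
  wᵢ-injective-< {t} {t′} t<t′ t′<k wᵢt≡wᵢt′ = outside≢neighbour (begin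
    outside                                         ≡⟨ trans (first-position k+t<k+t′ (k+t<k+k t′<k) pᵢ) pᵢ-first ⟨
    position H (z (k + t)) (F (k + t) (k + t′) pᵢ)  ≡⟨ cong (position H (z (k + t))) F≡wᵢt ⟩
    position H (z (k + t)) (wᵢ t)                   ≡⟨ second-position 0<k+t (k+t<k+k (<-trans t<t′ t′<k)) pᵢ ⟩
    position H (z k) (F 0 k pᵢ)                     ≡⟨ pᵢ-second ⟩
    neighbour _                                     ∎)
    where
      open ≡-Reasoning
      k+t<k+t′ = +-monoʳ-< k t<t′
      F≡wᵢt = trans (wᵢ-anchor k+t<k+t′ t′<k) (sym wᵢt≡wᵢt′)

  -- F t t′ pⱼ is wⱼ t but lies outside N(z t′), while wⱼ t′ does not
  wⱼ-injective-< : ∀ {t t′} → t < t′ → t′ < k → wⱼ t ≢ wⱼ t′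
  wⱼ-injective-< {t} {t′} t<t′ t′<k wⱼt≡wⱼt′ = outside≢neighbour (begin
    outside                           ≡⟨ trans (second-position t<t′ t′<k+k pⱼ) pⱼ-second ⟨
    position H (z t′) (F t t′ pⱼ)     ≡⟨ cong (position H (z t′)) F≡wⱼt′ ⟩
    position H (z t′) (wⱼ t′)         ≡⟨ first-position t′<k k<k+k pⱼ ⟩
    position H (z 0) (F 0 k pⱼ)       ≡⟨ pⱼ-first ⟩
    neighbour _                       ∎)
    where
      open ≡-Reasoning
      t′<k+k = <-trans t′<k k<k+k
      F≡wⱼt′ = trans (wⱼ-anchor t<t′ t′<k+k (<-trans t<t′ t′<k)) wⱼt≡wⱼt′

  wᵢ≢wⱼ : ∀ {t t′} → t < k → t′ < k → wᵢ t ≢ wⱼ t′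
  wᵢ≢wⱼ t<k t′<k eq = pᵢ~pⱼ (cong proj₁ (F-injective (t<k+t′ t′<k) (k+t<k+k t<k) pᵢ pⱼ
    (trans (wᵢ-anchor (t<k+t′ t′<k) t<k) (trans eq (sym (wⱼ-anchor (t<k+t′ t′<k) (k+t<k+k t<k) t′<k))))))

  wᵢ≢elsewhere : ∀ {t q} → t < k → Elsewhere q → wᵢ t ≢ F 0 k q
  wᵢ≢elsewhere t<k q-else@(q∉i , _) eq = q∉i (trans (cong proj₁ (sym pᵢ≡q)) pᵢ∈i)
    where
      pᵢ≡q = F-injective 0<k+t (k+t<k+k t<k) pᵢ _ (trans eq (sym (elsewhere-anchor-first q-else 0<k+t (k+t<k+k t<k))))

  wⱼ≢elsewhere : ∀ {t q} → t < k → Elsewhere q → wⱼ t ≢ F 0 k q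
  wⱼ≢elsewhere t<k q-else@(_ , q∉j) eq = q∉j (trans (cong proj₁ (sym pⱼ≡q)) pⱼ∈j)
    where
      pⱼ≡q = F-injective t<k k<k+k pⱼ _ (trans eq (sym (elsewhere-anchor-second q-else t<k)))

  injective-below-k : {g : ℕ → Fin n} → (∀ {t t′} → t < t′ → t′ < k → g t ≢ g t′) →
                      ∀ {t t′} → t < k → t′ < k → g t ≡ g t′ → t ≡ t′
  injective-below-k g-< {t} {t′} t<k t′<k eq with <-cmp t t′
  ... | tri< t<t′ _ _ = ⊥-elim (g-< t<t′ t′<k eq)
  ... | tri≈ _ t≡t′ _ = t≡t′
  ... | tri> _ _ t′<t = ⊥-elim (g-< t′<t t<k (sym eq))

  index : KVert s → ℕ
  index p = toℕ (proj₂ p)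

  index<k : ∀ p → index p < k
  index<k (i , t) = <-≤-trans (toℕ<n t) (≤-trans (lookup≤vsum s i) (<⇒≤ vsum<k))

  data Role (p : KVert s) : Set where
    in-i      : proj₁ p ≡ i → Role p
    in-j      : proj₁ p ≡ j → Role p
    elsewhere : Elsewhere p → Role p

  role : ∀ p → Role p
  role p with proj₁ p Fin.≟ i | proj₁ p Fin.≟ j
  ... | yes p∈i | _       = in-i p∈i
  ... | no _    | yes p∈j = in-j p∈j
  ... | no p∉i  | no p∉j  = elsewhere (p∉i , p∉j)

  place : ∀ p → Role p → Fin n
  place p (in-i _)      = wᵢ (index p)
  place p (in-j _)      = wⱼ (index p)
  place p (elsewhere _) = F 0 k p

  place-adj : ∀ p q (ρ : Role p) (σ : Role q) → KAdj s p q → Adj H (place p ρ) (place q σ)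
  place-adj p q (in-i p∈i)      (in-i q∈i)      pq = ⊥-elim (pq (trans p∈i (sym q∈i)))
  place-adj p q (in-i _)        (in-j _)        _  = wᵢ~wⱼ (index<k p) (index<k q)
  place-adj p q (in-i _)        (elsewhere q′)  _  = wᵢ~elsewhere (index<k p) q′
  place-adj p q (in-j _)        (in-i _)        _  = Adj-sym {H = H} (wᵢ~wⱼ (index<k q) (index<k p))
  place-adj p q (in-j p∈j)      (in-j q∈j)      pq = ⊥-elim (pq (trans p∈j (sym q∈j)))
  place-adj p q (in-j _)        (elsewhere q′)  _  = wⱼ~elsewhere (index<k p) q′
  place-adj p q (elsewhere p′)  (in-i _)        _  = Adj-sym {H = H} (wᵢ~elsewhere (index<k q) p′)
  place-adj p q (elsewhere p′)  (in-j _)        _  = Adj-sym {H = H} (wⱼ~elsewhere (index<k q) p′)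
  place-adj p q (elsewhere p′)  (elsewhere _)   pq = elsewhere~ p′ pq

  place-injective : ∀ p q (ρ : Role p) (σ : Role q) → place p ρ ≡ place q σ → p ≡ q
  place-injective p q (in-i p∈i)     (in-i q∈i)     eq =
    KVert-≡ {s = s} (trans p∈i (sym q∈i)) (injective-below-k wᵢ-injective-< (index<k p) (index<k q) eq)
  place-injective p q (in-i _)       (in-j _)       eq = ⊥-elim (wᵢ≢wⱼ (index<k p) (index<k q) eq)
  place-injective p q (in-i _)       (elsewhere q′) eq = ⊥-elim (wᵢ≢elsewhere (index<k p) q′ eq)
  place-injective p q (in-j _)       (in-i _)       eq = ⊥-elim (wᵢ≢wⱼ (index<k q) (index<k p) (sym eq))
  place-injective p q (in-j p∈j)     (in-j q∈j)     eq =
    KVert-≡ {s = s} (trans p∈j (sym q∈j)) (injective-below-k wⱼ-injective-< (index<k p) (index<k q) eq)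
  place-injective p q (in-j _)       (elsewhere q′) eq = ⊥-elim (wⱼ≢elsewhere (index<k p) q′ eq)
  place-injective p q (elsewhere p′) (in-i _)       eq = ⊥-elim (wᵢ≢elsewhere (index<k q) p′ (sym eq))
  place-injective p q (elsewhere p′) (in-j _)       eq = ⊥-elim (wⱼ≢elsewhere (index<k q) p′ (sym eq))
  place-injective p q (elsewhere _)  (elsewhere _)  eq = F-injective 0<k k<k+k p q eq

  K-in-H : ContainsK s H
  K-in-H = (λ p → place p (role p)) ,
           (λ p q → place-injective p q (role p) (role q)) ,
           (λ p q → place-adj p q (role p) (role q))

maxSize : Vec ℕ r → ℕ
maxSize s = ramseyNumber (length (palette s (2 * vsum s))) (k + k)
  where k = 2 + vsum s

large-sparse-set⇒K : ∀ {H : Graph n} {s : Vec ℕ r} → Saturated s H → (M : List (Fin n)) → Unique M →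
  All (λ x → deg H x ≤ 2 * vsum s) M →
  (∀ {u v} → u ∈ M → v ∈ M → u ≢ v → ∀ j → codeg H u v + lookup s j + 2 ≤ vsum s) →
  maxSize s < length M → ContainsK s H
large-sparse-set⇒K {H = H} {s} sat M M! M-deg M-sparse big =
  FromHomogeneousSequence.K-in-H {H = H} {s = s} sat k (s≤s (s≤s z≤n)) (m<n+m (vsum s) z<s)
                                 z z-distinct z-homogeneous z-sparse
  where
    open Colouring {H = H} {s = s} sat
    k = 2 + vsum s
    open Ramsey (Data.List.Properties.≡-dec _≟ₚ_) (palette s (2 * vsum s)) colour
    sequence = ramsey (k + k) M M!
      (λ u∈ v∈ → colour-∈-palette (All.lookup M-deg u∈) (All.lookup M-deg v∈)) (<⇒≤ big)
    z = proj₁ sequence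
    z∈M = proj₁ (proj₂ (proj₂ sequence))
    z-monochromatic = proj₂ (proj₂ (proj₂ sequence))
    0<k = s≤s z≤n
    k<k+k = m<m+n k 0<k

    z-distinct : ∀ {a b} → a < b → b < k + k → z a ≢ z b
    z-distinct a<b b<2k = proj₁ (z-monochromatic a<b b<2k)

    z-homogeneous : ∀ {a b} → a < b → b < k + k → colour (z a) (z b) ≡ colour (z 0) (z k)
    z-homogeneous a<b b<2k = trans (proj₂ (z-monochromatic a<b b<2k)) (sym (proj₂ (z-monochromatic 0<k k<k+k)))

    z-sparse : ∀ j → codeg H (z 0) (z k) + lookup s j + 2 ≤ vsum s
    z-sparse = M-sparse (z∈M (<-trans 0<k k<k+k)) (z∈M k<k+k) (z-distinct 0<k k<k+k)

lemma3p2 : (r : ℕ) → 2 ≤ r → (s : Vec ℕ r) → SortedPos s →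
    Σ ℕ λ C →
      (n : ℕ) (H : Graph n) → Saturated s H →
      (M : List (Fin n)) → Unique M →
      All (λ x → deg H x + lastPart s + 4 ≤ 2 * vsum s) M →
      (∀ u v → u ∈ M → v ∈ M → ¬ (u ≡ v) → codeg H u v + lastPart s + 2 ≤ vsum s) →
      length M ≤ C
lemma3p2 r _ s (_ , sorted) = maxSize s , λ n H sat M M! M-deg M-sparse →
  ≮⇒≥ λ big → proj₁ sat (large-sparse-set⇒K {H = H} {s = s} sat M M! (All.map low-degree M-deg)
                           (λ u∈ v∈ u≢v j → sparse-everywhere (M-sparse _ _ u∈ v∈ u≢v) j) big)
  where
    low-degree : ∀ {d} → d + lastPart s + 4 ≤ 2 * vsum s → d ≤ 2 * vsum s
    low-degree {d} bound = m+n≤o⇒m≤o d (m+n≤o⇒m≤o (d + lastPart s) bound)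

    sparse-everywhere : ∀ {c} → c + lastPart s + 2 ≤ vsum s → ∀ j → c + lookup s j + 2 ≤ vsum s
    sparse-everywhere {c} bound j = ≤-trans (+-monoˡ-≤ 2 (+-monoʳ-≤ c (lookup≤lastPart s sorted j))) bound
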